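{- Let $t,w\in\mathbf{PBT}_n$ with $t=t_0\,\underline{\circ}\,(t_1,\dots,t_r)$ and $w=w_0\,\underline{\circ}\,(w_1,\dots,w_r)$, where $t_0,w_0\in\mathbf{PBT}_r$ and $t_i,w_i\in\mathbf{PBT}_{n_i}$ for $1\le i\le r$, with $\sum_{i=1}^rn_i=n$. (1) If $t\le_Tw$, then $t_0\le_Tw_0$ and $t_i\le_Tw_i$ for all $1\le i\le r$. (2) Every $u$ with $t\le_Tu\le_Tw$ is of the form $u=u_0\,\underline{\circ}\,(u_1,\dots,u_r)$ with $u_0\in\mathbf{PBT}_r$ and $u_i\in\mathbf{PBT}_{n_i}$ for $1\le i\le r$.
   Context: Planar binary rooted trees: every internal vertex has two children; $\mathbf{PBT}_n$ = such trees with $n$ leaves (numbered left to right), $\mathbf{PBT}_1=\{\vert\}$. $t\veebar w$ joins the roots of $t$ (left) and $w$ (right) to a new root. $t\circ_jw$ identifies the root of $w$ with the $j$-th leaf of $t$; for $t$ with $r$ leaves, $t\,\underline{\circ}\,(w_1,\dots,w_r)=(((t\circ_rw_r)\circ_{r-1}w_{r-1})\cdots)\circ_1w_1$. The Tamari order $\le_T$ on $\mathbf{PBT}_n$ is the partial order generated by $(t_1\veebar t_2)\veebar t_3\le_Tt_1\veebar(t_2\veebar t_3)$ and by $t_1\le_Tw_1,t_2\le_Tw_2\Rightarrow t_1\veebar t_2\le_Tw_1\veebar w_2$. -}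

module Defs where

open import Data.Nat using (ℕ; zero; suc; _+_; _∸_; _<ᵇ_)
open import Data.Bool using (if_then_else_)
open import Data.Vec using (Vec; []; _∷_)

-- Planar binary rooted trees; PBT_n = trees t with leaves t ≡ n.
data Tree : Set where
  ∣    : Tree
  _⊻_ : Tree → Tree → Tree

infixr 5 _⊻_

leaves : Tree → ℕ
leaves ∣       = 1
leaves (t ⊻ w) = leaves t + leaves w

-- graft₀ t k w : identify the root of w with the leaf of t at 0-based
-- position k (from the left); unchanged if t has ≤ k leaves.
graft₀ : Tree → ℕ → Tree → Tree
graft₀ ∣ zero    w = w
graft₀ ∣ (suc k) w = ∣
graft₀ (a ⊻ b) k w =
  if k <ᵇ leaves a then graft₀ a k w ⊻ b else a ⊻ graft₀ b (k ∸ leaves a) w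

-- t ∘[ j ] w : identify the root of w with the j-th leaf of t
-- (leaves numbered 1,2,... left to right; j = 0 is meaningless and
-- returns t, never used).
_∘[_]_ : Tree → ℕ → Tree → Tree
t ∘[ zero  ] w = t
t ∘[ suc j ] w = graft₀ t j w

graftFrom : ∀ {r} → Tree → ℕ → Vec Tree r → Tree
graftFrom t k []       = t
graftFrom t k (x ∷ xs) = graftFrom t (suc k) xs ∘[ k ] x

-- t ∘̲ (w_1,…,w_r) = (((t ∘_r w_r) ∘_{r-1} w_{r-1}) ⋯) ∘_1 w_1
_∘̲_ : ∀ {r} → Tree → Vec Tree r → Tree
t ∘̲ ws = graftFrom t 1 ws

data _≤T_ : Tree → Tree → Set where
  ≤T-refl  : ∀ {t} → t ≤T t
  ≤T-trans : ∀ {t u w} → t ≤T u → u ≤T w → t ≤T w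
  ≤T-rot   : ∀ {t₁ t₂ t₃} → ((t₁ ⊻ t₂) ⊻ t₃) ≤T (t₁ ⊻ (t₂ ⊻ t₃))
  ≤T-⊻     : ∀ {t₁ t₂ w₁ w₂} → t₁ ≤T w₁ → t₂ ≤T w₂ → (t₁ ⊻ t₂) ≤T (w₁ ⊻ w₂)

infix 4 _≤T_

{-# OPTIONS --safe #-}
module Submission where

-- Deleting the leaves outside a set of positions
-- (and contracting the nodes left with one child) is monotone for ≤T: a rotation or a ⊻ either
-- survives the deletion or degenerates to an equality. Keeping one leaf per block turns
-- t₀ ∘̲ (t₁,…,t_r) into t₀, keeping the i-th block turns it into tᵢ; this gives (1).
--
-- The leaves of a subtree form an interval, its span. Along t ≤T w every span [x,y) of t
-- survives as a span [x,y′) of w with y ≤ y′, and the spans of one tree never cross. Hence the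
-- blocks, being spans of both t and w, are spans of every u in between, and a tree whose
-- blocks are spans is a composite u₀ ∘̲ (u₁,…,u_r); this gives (2).

open import Defs
open import Data.Nat
open import Data.Nat.Properties
open import Data.Bool using (true; false)
open import Data.Fin using (Fin; toℕ) renaming (zero to fzero; suc to fsuc)
open import Data.Fin.Properties using (toℕ<n)
open import Data.List using (applyUpTo)
open import Data.List.Membership.DecPropositional _≟_ using (_∈?_)
open import Data.List.Membership.Propositional.Properties using (∈-applyUpTo⁺; ∈-applyUpTo⁻)
open import Data.Maybe using (Maybe; just; nothing)
open import Data.Maybe.Relation.Binary.Pointwise as Pointwise using (Pointwise; just; nothing; drop-just)
open import Data.Product using (_×_; Σ-syntax; _,_)
open import Data.Sum using (inj₁; inj₂)
open import Data.Vec using (Vec; []; _∷_; lookup; tabulate; sum)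
open import Data.Vec.Properties using (lookup∘tabulate)
open import Function using (_∘_; case_of_)
open import Relation.Binary.Definitions using (tri<; tri≈; tri>)
open import Relation.Binary.PropositionalEquality
open import Relation.Nullary using (¬_; Dec; yes; no; ofʸ; ofⁿ; contradiction; _×-dec_)

leaves-positive : ∀ t → 0 < leaves t
leaves-positive ∣       = z<s
leaves-positive (a ⊻ b) = <-≤-trans (leaves-positive a) (m≤m+n (leaves a) (leaves b))

≤T⇒leaves≡ : ∀ {t w} → t ≤T w → leaves t ≡ leaves w
≤T⇒leaves≡ ≤T-refl              = refl
≤T⇒leaves≡ (≤T-trans p q)       = trans (≤T⇒leaves≡ p) (≤T⇒leaves≡ q)
≤T⇒leaves≡ (≤T-rot {a} {b} {c}) = +-assoc (leaves a) (leaves b) (leaves c)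
≤T⇒leaves≡ (≤T-⊻ p q)           = cong₂ _+_ (≤T⇒leaves≡ p) (≤T⇒leaves≡ q)

graft₀-⊻-left : ∀ {a b k w} → k < leaves a → graft₀ (a ⊻ b) k w ≡ graft₀ a k w ⊻ b
graft₀-⊻-left {a} {k = k} k<a with k <ᵇ leaves a | <ᵇ-reflects-< k (leaves a)
... | true  | _       = refl
... | false | ofⁿ k≮a = contradiction k<a k≮a

graft₀-⊻-right : ∀ {a b k w} → leaves a ≤ k → graft₀ (a ⊻ b) k w ≡ a ⊻ graft₀ b (k ∸ leaves a) w
graft₀-⊻-right {a} {k = k} a≤k with k <ᵇ leaves a | <ᵇ-reflects-< k (leaves a)
... | true  | ofʸ k<a = contradiction a≤k (<⇒≱ k<a)
... | false | _       = refl

On : ℕ → ℕ → (ℕ → Set) → Set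
On o n Q = ∀ p → o ≤ p → p < o + n → Q p

module _ {Q : ℕ → Set} {o : ℕ} where

  On-here : On o 1 Q → Q o
  On-here h = h o ≤-refl (m<m+n o z<s)

  On-single : Q o → On o 1 Q
  On-single q p o≤p p<o+1 = subst Q (≤-antisym o≤p (m<1+n⇒m≤n (subst (p <_) (+-comm o 1) p<o+1))) q

  On-map : ∀ {n} {R : ℕ → Set} → (∀ {p} → Q p → R p) → On o n Q → On o n R
  On-map f h p o≤p p< = f (h p o≤p p<)

  On-left : ∀ m {n} → On o (m + n) Q → On o m Q
  On-left m {n} h p o≤p p< = h p o≤p (<-≤-trans p< (+-monoʳ-≤ o (m≤m+n m n)))

  On-right : ∀ m {n} → On o (m + n) Q → On (o + m) n Q
  On-right m {n} h p o+m≤p p< = h p (≤-trans (m≤m+n o m) o+m≤p) (subst (p <_) (+-assoc o m n) p<)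

  On-join : ∀ m {n} → On o m Q → On (o + m) n Q → On o (m + n) Q
  On-join m {n} hl hr p o≤p p< with p <? o + m
  ... | yes p<o+m = hl p o≤p p<o+m
  ... | no  p≮o+m = hr p (≮⇒≥ p≮o+m) (subst (p <_) (sym (+-assoc o m n)) p<)

module _ {A : Set} where

  splice : ℕ → (ℕ → A) → (ℕ → A) → ℕ → A
  splice m f g j with j <? m
  ... | yes _ = f j
  ... | no  _ = g j

  splice-< : ∀ {m f g j} → j < m → splice m f g j ≡ f j
  splice-< {m} {j = j} j<m with j <? m
  ... | yes _   = refl
  ... | no  j≮m = contradiction j<m j≮m

  splice-≥ : ∀ {m f g j} → m ≤ j → splice m f g j ≡ g j
  splice-≥ {m} {j = j} m≤j with j <? m
  ... | yes j<m = contradiction m≤j (<⇒≱ j<m)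
  ... | no  _   = refl

graftAll : Tree → (ℕ → Tree) → ℕ → Tree
graftAll ∣       f o = f o
graftAll (a ⊻ b) f o = graftAll a f o ⊻ graftAll b f (o + leaves a)

graftAll-cong : ∀ t {f g o} → On o (leaves t) (λ p → f p ≡ g p) → graftAll t f o ≡ graftAll t g o
graftAll-cong ∣       f≗g = On-here f≗g
graftAll-cong (a ⊻ b) f≗g =
  cong₂ _⊻_ (graftAll-cong a (On-left (leaves a) f≗g)) (graftAll-cong b (On-right (leaves a) f≗g))

graftAll-∣ : ∀ t {f o} → On o (leaves t) (λ p → f p ≡ ∣) → graftAll t f o ≡ t
graftAll-∣ ∣       f≗∣ = On-here f≗∣
graftAll-∣ (a ⊻ b) f≗∣ =
  cong₂ _⊻_ (graftAll-∣ a (On-left (leaves a) f≗∣)) (graftAll-∣ b (On-right (leaves a) f≗∣))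

leaves-≤-graftAll : ∀ t f o → leaves t ≤ leaves (graftAll t f o)
leaves-≤-graftAll ∣       f o = leaves-positive (f o)
leaves-≤-graftAll (a ⊻ b) f o = +-mono-≤ (leaves-≤-graftAll a f o) (leaves-≤-graftAll b f (o + leaves a))

-- As f leaves the positions up to x bare, leaf k of graftAll t f o is the leaf at position x of t.
graft₀-graftAll : ∀ t {f g o k x w} → o + k ≡ x →
  (∀ p → p ≤ x → f p ≡ ∣) → g x ≡ w → (∀ p → p ≢ x → g p ≡ f p) →
  graft₀ (graftAll t f o) k w ≡ graftAll t g o
graft₀-graftAll ∣ {f} {o = o} {zero} refl f∣ gx _ rewrite f∣ o (m≤m+n o 0) | +-identityʳ o = sym gx
graft₀-graftAll ∣ {f} {g} {o} {suc k} refl f∣ _ g≗f rewrite f∣ o (m≤m+n o (suc k)) =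
  sym (trans (g≗f o (<⇒≢ (m<m+n o z<s))) (f∣ o (m≤m+n o (suc k))))
graft₀-graftAll (a ⊻ b) {f} {g} {o} {k} {x} {w} o+k≡x f∣ gx g≗f with k <? leaves a
... | yes k<a =
  trans (graft₀-⊻-left (<-≤-trans k<a (leaves-≤-graftAll a f o)))
    (cong₂ _⊻_ (graft₀-graftAll a o+k≡x f∣ gx g≗f)
               (graftAll-cong b λ p o+a≤p _ →
                  sym (g≗f p (>⇒≢ (subst (_< p) o+k≡x (<-≤-trans (+-monoʳ-< o k<a) o+a≤p))))))
... | no k≮a =
  trans (cong (λ a′ → graft₀ (a′ ⊻ graftAll b f (o + leaves a)) k w)
              (graftAll-∣ a λ p _ p< → f∣ p (≤x p<)))
    (trans (graft₀-⊻-right a≤k)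
      (cong₂ _⊻_ (sym (graftAll-∣ a λ p _ p< →
                    trans (g≗f p (<⇒≢ (<-≤-trans p< o+a≤x))) (f∣ p (≤x p<))))
                 (graft₀-graftAll b (trans (+-assoc o (leaves a) (k ∸ leaves a))
                                       (trans (cong (o +_) (m+[n∸m]≡n a≤k)) o+k≡x)) f∣ gx g≗f)))
  where
  a≤k : leaves a ≤ k
  a≤k = ≮⇒≥ k≮a
  o+a≤x : o + leaves a ≤ x
  o+a≤x = subst (o + leaves a ≤_) o+k≡x (+-monoʳ-≤ o a≤k)
  ≤x : ∀ {p} → p < o + leaves a → p ≤ x
  ≤x p< = <⇒≤ (<-≤-trans p< o+a≤x)

lookupFrom : ∀ {A : Set} {r} → A → ℕ → Vec A r → ℕ → A
lookupFrom d (suc k) xs       zero    = d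
lookupFrom d (suc k) xs       (suc p) = lookupFrom d k xs p
lookupFrom d zero    []       p       = d
lookupFrom d zero    (x ∷ xs) zero    = x
lookupFrom d zero    (x ∷ xs) (suc p) = lookupFrom d zero xs p

module _ {A : Set} {d : A} where

  lookupFrom-[] : ∀ k p → lookupFrom d k [] p ≡ d
  lookupFrom-[] zero    p       = refl
  lookupFrom-[] (suc k) zero    = refl
  lookupFrom-[] (suc k) (suc p) = lookupFrom-[] k p

  lookupFrom-< : ∀ {r k p} {xs : Vec A r} → p < k → lookupFrom d k xs p ≡ d
  lookupFrom-< {k = suc k} {zero}  _         = refl
  lookupFrom-< {k = suc k} {suc p} (s<s p<k) = lookupFrom-< p<k

  lookupFrom-here : ∀ {r} k {x} {xs : Vec A r} → lookupFrom d k (x ∷ xs) k ≡ x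
  lookupFrom-here zero    = refl
  lookupFrom-here (suc k) = lookupFrom-here k

  lookupFrom-≢ : ∀ {r k p x} {xs : Vec A r} → p ≢ k → lookupFrom d k (x ∷ xs) p ≡ lookupFrom d (suc k) xs p
  lookupFrom-≢ {k = zero}  {zero}  p≢k = contradiction refl p≢k
  lookupFrom-≢ {k = zero}  {suc p} _   = refl
  lookupFrom-≢ {k = suc k} {zero}  _   = refl
  lookupFrom-≢ {k = suc k} {suc p} p≢k = lookupFrom-≢ (p≢k ∘ cong suc)

  lookupFrom-toℕ : ∀ {r} (xs : Vec A r) i → lookupFrom d 0 xs (toℕ i) ≡ lookup xs i
  lookupFrom-toℕ (x ∷ xs) fzero    = refl
  lookupFrom-toℕ (x ∷ xs) (fsuc i) = lookupFrom-toℕ xs i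

  lookupFrom-tabulate : ∀ {r} (f : ℕ → A) {p} → p < r → lookupFrom d 0 (tabulate {n = r} (f ∘ toℕ)) p ≡ f p
  lookupFrom-tabulate {suc r} f {zero}  _         = refl
  lookupFrom-tabulate {suc r} f {suc p} (s<s p<r) = lookupFrom-tabulate (f ∘ suc) p<r

lookupFrom-pointwise : ∀ {A B : Set} {d : A} {e : B} {R : A → B → Set} {r} {xs : Vec A r} {ys : Vec B r} →
  (∀ i → R (lookup xs i) (lookup ys i)) → ∀ {p} → p < r → R (lookupFrom d 0 xs p) (lookupFrom e 0 ys p)
lookupFrom-pointwise {xs = x ∷ xs} {y ∷ ys} R-xy {zero} _ = R-xy fzero
lookupFrom-pointwise {R = R} {xs = x ∷ xs} {y ∷ ys} R-xy {suc p} (s<s p<r) =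
  lookupFrom-pointwise {R = R} {xs = xs} {ys} (R-xy ∘ fsuc) p<r

graftFrom-graftAll : ∀ {r} t k (xs : Vec Tree r) → graftFrom t (suc k) xs ≡ graftAll t (lookupFrom ∣ k xs) 0
graftFrom-graftAll t k []       = sym (graftAll-∣ t λ p _ _ → lookupFrom-[] k p)
graftFrom-graftAll t k (x ∷ xs) =
  trans (cong (λ s → graft₀ s k x) (graftFrom-graftAll t (suc k) xs))
        (graft₀-graftAll t refl (λ _ p≤k → lookupFrom-< (s≤s p≤k)) (lookupFrom-here k) (λ _ → lookupFrom-≢))

∘̲≡graftAll : ∀ {r} t (xs : Vec Tree r) → t ∘̲ xs ≡ graftAll t (lookupFrom ∣ 0 xs) 0
∘̲≡graftAll t = graftFrom-graftAll t 0

graftAll≡∘̲ : ∀ {r} t f → leaves t ≡ r → graftAll t f 0 ≡ t ∘̲ tabulate {n = r} (f ∘ toℕ)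
graftAll≡∘̲ t f refl = trans (graftAll-cong t λ _ _ p<t → sym (lookupFrom-tabulate {d = ∣} f p<t))
                             (sym (∘̲≡graftAll t (tabulate {n = leaves t} (f ∘ toℕ))))

-- Span t o x y: when the leaves of t are numbered o, o+1, …, those of some subtree of t are
-- numbered x, …, y-1.
data Span : Tree → ℕ → ℕ → ℕ → Set where
  root    : ∀ {t o} → Span t o o (o + leaves t)
  inLeft  : ∀ {a b o x y} → Span a o x y → Span (a ⊻ b) o x y
  inRight : ∀ {a b o x y} → Span b (o + leaves a) x y → Span (a ⊻ b) o x y

Span-lower : ∀ {t o x y} → Span t o x y → o ≤ x
Span-lower root                    = ≤-refl
Span-lower (inLeft s)              = Span-lower s
Span-lower (inRight {a} {o = o} s) = ≤-trans (m≤m+n o (leaves a)) (Span-lower s)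

Span-upper : ∀ {t o x y} → Span t o x y → y ≤ o + leaves t
Span-upper root                    = ≤-refl
Span-upper (inLeft {a} {b} {o} s)  = ≤-trans (Span-upper s) (+-monoʳ-≤ o (m≤m+n (leaves a) (leaves b)))
Span-upper (inRight {a} {b} {o} s) = ≤-trans (Span-upper s) (≤-reflexive (+-assoc o (leaves a) (leaves b)))

Span-nonempty : ∀ {t o x y} → Span t o x y → x < y
Span-nonempty (root {t} {o}) = m<m+n o (leaves-positive t)
Span-nonempty (inLeft s)     = Span-nonempty s
Span-nonempty (inRight s)    = Span-nonempty s

Span-offset : ∀ {t o o′ x y} → o ≡ o′ → Span t o x y → Span t o′ x y
Span-offset refl s = s

Span-∣-end : ∀ {o x y} → Span ∣ o x y → y ≡ o + 1
Span-∣-end root = refl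

Span-⊻-crossing : ∀ {a b o x y} → Span (a ⊻ b) o x y → x < o + leaves a → o + leaves a < y →
  x ≡ o × y ≡ o + leaves (a ⊻ b)
Span-⊻-crossing root        _     _     = refl , refl
Span-⊻-crossing (inLeft s)  _     mid<y = contradiction (Span-upper s) (<⇒≱ mid<y)
Span-⊻-crossing (inRight s) x<mid _     = contradiction (Span-lower s) (<⇒≱ x<mid)

Span-⊻⁻ˡ : ∀ {a b o x y} → Span (a ⊻ b) o x y → y ≤ o + leaves a → Span a o x y
Span-⊻⁻ˡ {a} {b} (root {o = o}) y≤mid =
  contradiction y≤mid (<⇒≱ (+-monoʳ-< o (m<m+n (leaves a) (leaves-positive b))))
Span-⊻⁻ˡ (inLeft s)  _     = s
Span-⊻⁻ˡ (inRight s) y≤mid = contradiction (≤-trans y≤mid (Span-lower s)) (<⇒≱ (Span-nonempty s))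

Span-⊻⁻ʳ : ∀ {a b o x y} → Span (a ⊻ b) o x y → o + leaves a ≤ x → Span b (o + leaves a) x y
Span-⊻⁻ʳ {a} (root {o = o}) mid≤o = contradiction mid≤o (<⇒≱ (m<m+n o (leaves-positive a)))
Span-⊻⁻ʳ (inLeft s)  mid≤x = contradiction (≤-trans (Span-upper s) mid≤x) (<⇒≱ (Span-nonempty s))
Span-⊻⁻ʳ (inRight s) _     = s

Span-nested : ∀ {w o x y c e} → Span w o x y → Span w o c e → x < c → c < y → e ≤ y
Span-nested root         s₂           _   _   = Span-upper s₂
Span-nested (inLeft s₁)  (inLeft s₂)  x<c c<y = Span-nested s₁ s₂ x<c c<y
Span-nested (inRight s₁) (inRight s₂) x<c c<y = Span-nested s₁ s₂ x<c c<y
Span-nested (inLeft s₁)  root         x<c _   = contradiction (Span-lower s₁) (<⇒≱ x<c)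
Span-nested (inRight s₁) root         x<c _   = contradiction (≤-trans (m≤m+n _ _) (Span-lower s₁)) (<⇒≱ x<c)
Span-nested (inLeft s₁)  (inRight s₂) _   c<y =
  contradiction (≤-trans (Span-upper s₁) (Span-lower s₂)) (<⇒≱ c<y)
Span-nested (inRight s₁) (inLeft s₂)  x<c _   =
  contradiction (Span-lower s₁) (<⇒≱ (<-trans x<c (<-≤-trans (Span-nonempty s₂) (Span-upper s₂))))

Span-trim : ∀ {u o x y y′} → Span u o x y′ → x < y → y ≤ y′ →
  (∀ {c e} → x < c → c < y → Span u o c e → e ≤ y) → Span u o x y
Span-trim {∣} {o} {y = y} root x<y y≤y′ _ =
  subst (Span ∣ o o) (≤-antisym (subst (_≤ y) (+-comm 1 o) x<y) y≤y′) root
Span-trim {l ⊻ r} {o} {y = y} root x<y y≤y′ ends≤y with y ≟ o + leaves (l ⊻ r)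
... | yes refl = root
... | no y≢y′ with o + leaves l <? y
...   | yes mid<y =
  contradiction (≤-trans (≤-reflexive (sym (+-assoc o (leaves l) (leaves r))))
                         (ends≤y (m<m+n o (leaves-positive l)) mid<y (inRight root)))
                (<⇒≱ (≤∧≢⇒< y≤y′ y≢y′))
...   | no  mid≮y = inLeft (Span-trim root x<y (≮⇒≥ mid≮y) λ x<c c<y → ends≤y x<c c<y ∘ inLeft)
Span-trim (inLeft s)  x<y y≤y′ ends≤y = inLeft  (Span-trim s x<y y≤y′ λ x<c c<y → ends≤y x<c c<y ∘ inLeft)
Span-trim (inRight s) x<y y≤y′ ends≤y = inRight (Span-trim s x<y y≤y′ λ x<c c<y → ends≤y x<c c<y ∘ inRight)

_≼_ : Tree → Tree → Set
t ≼ w = ∀ {o x y} → Span t o x y → Σ[ y′ ∈ ℕ ] y ≤ y′ × Span w o x y′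

-- A rotation replaces the span of t₁ ⊻ t₂ by the longer one of the whole tree, which starts at
-- the same leaf; every other span survives.
≤T⇒≼ : ∀ {t w} → t ≤T w → t ≼ w
≤T⇒≼ ≤T-refl s = _ , ≤-refl , s
≤T⇒≼ (≤T-trans p q) s with ≤T⇒≼ p s
... | _ , y≤y₁ , s₁ with ≤T⇒≼ q s₁
...   | _ , y₁≤y₂ , s₂ = _ , ≤-trans y≤y₁ y₁≤y₂ , s₂
≤T⇒≼ (≤T-rot {a} {b} {c}) (root {o = o}) =
  _ , ≤-reflexive (cong (o +_) (+-assoc (leaves a) (leaves b) (leaves c))) , root
≤T⇒≼ (≤T-rot {a} {b} {c}) (inLeft (root {o = o})) =
  _ , +-monoʳ-≤ o (+-monoʳ-≤ (leaves a) (m≤m+n (leaves b) (leaves c))) , root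
≤T⇒≼ ≤T-rot (inLeft (inLeft s))  = _ , ≤-refl , inLeft s
≤T⇒≼ ≤T-rot (inLeft (inRight s)) = _ , ≤-refl , inRight (inLeft s)
≤T⇒≼ (≤T-rot {a} {b}) (inRight {o = o} s) =
  _ , ≤-refl , inRight (inRight (Span-offset (sym (+-assoc o (leaves a) (leaves b))) s))
≤T⇒≼ (≤T-⊻ p q) (root {o = o}) = _ , ≤-reflexive (cong (o +_) (≤T⇒leaves≡ (≤T-⊻ p q))) , root
≤T⇒≼ (≤T-⊻ p q) (inLeft s) with ≤T⇒≼ p s
... | _ , y≤y′ , s′ = _ , y≤y′ , inLeft s′
≤T⇒≼ (≤T-⊻ p q) (inRight {o = o} s) with ≤T⇒≼ q s
... | _ , y≤y′ , s′ = _ , y≤y′ , inRight (Span-offset (cong (o +_) (≤T⇒leaves≡ p)) s′)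

Span-between : ∀ {t u w o x y} → t ≤T u → u ≤T w → Span t o x y → Span w o x y → Span u o x y
Span-between {x = x} {y} t≤u u≤w sₜ s_w with ≤T⇒≼ t≤u sₜ
... | _ , y≤y′ , sᵤ = Span-trim sᵤ (Span-nonempty sₜ) y≤y′ ends≤y
  where
  ends≤y : ∀ {c e} → x < c → c < y → Span _ _ c e → e ≤ y
  ends≤y x<c c<y s with ≤T⇒≼ u≤w s
  ... | _ , e≤e′ , s′ = ≤-trans e≤e′ (Span-nested s_w s′ x<c c<y)

_⊻ᵐ_ : Maybe Tree → Maybe Tree → Maybe Tree
nothing ⊻ᵐ y       = y
just x  ⊻ᵐ nothing = just x
just x  ⊻ᵐ just y  = just (x ⊻ y)

⊻ᵐ-identityʳ : ∀ x → x ⊻ᵐ nothing ≡ x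
⊻ᵐ-identityʳ nothing  = refl
⊻ᵐ-identityʳ (just x) = refl

⊻ᵐ-mono : ∀ {x x′ y y′} → Pointwise _≤T_ x x′ → Pointwise _≤T_ y y′ →
  Pointwise _≤T_ (x ⊻ᵐ y) (x′ ⊻ᵐ y′)
⊻ᵐ-mono nothing  y≤y′     = y≤y′
⊻ᵐ-mono (just p) nothing  = just p
⊻ᵐ-mono (just p) (just q) = just (≤T-⊻ p q)

⊻ᵐ-rot : ∀ x y z → Pointwise _≤T_ ((x ⊻ᵐ y) ⊻ᵐ z) (x ⊻ᵐ (y ⊻ᵐ z))
⊻ᵐ-rot nothing  _        _        = Pointwise.refl ≤T-refl
⊻ᵐ-rot (just x) nothing  _        = Pointwise.refl ≤T-refl
⊻ᵐ-rot (just x) (just y) nothing  = Pointwise.refl ≤T-refl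
⊻ᵐ-rot (just x) (just y) (just z) = just ≤T-rot

prune : Tree → (ℕ → Maybe Tree) → ℕ → Maybe Tree
prune ∣       g o = g o
prune (a ⊻ b) g o = prune a g o ⊻ᵐ prune b g (o + leaves a)

prune-mono : ∀ {t w} → t ≤T w → ∀ g o → Pointwise _≤T_ (prune t g o) (prune w g o)
prune-mono ≤T-refl        g o = Pointwise.refl ≤T-refl
prune-mono (≤T-trans p q) g o = Pointwise.trans ≤T-trans (prune-mono p g o) (prune-mono q g o)
prune-mono (≤T-rot {a} {b} {c}) g o rewrite +-assoc o (leaves a) (leaves b) =
  ⊻ᵐ-rot (prune a g o) (prune b g (o + leaves a)) (prune c g (o + (leaves a + leaves b)))
prune-mono (≤T-⊻ {t₁} p q) g o rewrite sym (≤T⇒leaves≡ p) =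
  ⊻ᵐ-mono (prune-mono p g o) (prune-mono q g (o + leaves t₁))

prune-keepAll : ∀ t {g o} → On o (leaves t) (λ p → g p ≡ just ∣) → prune t g o ≡ just t
prune-keepAll ∣       keep = On-here keep
prune-keepAll (a ⊻ b) keep
  rewrite prune-keepAll a (On-left (leaves a) keep) | prune-keepAll b (On-right (leaves a) keep) = refl

prune-dropAll : ∀ t {g o} → On o (leaves t) (λ p → g p ≡ nothing) → prune t g o ≡ nothing
prune-dropAll ∣       drop = On-here drop
prune-dropAll (a ⊻ b) drop
  rewrite prune-dropAll a (On-left (leaves a) drop) | prune-dropAll b (On-right (leaves a) drop) = refl

prune-only : ∀ t {g o i} → o ≤ i → i < o + leaves t → On o (leaves t) (λ p → p ≢ i → g p ≡ nothing) →
  prune t g o ≡ g i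
prune-only ∣ {g} {o} {i} o≤i i<o+1 _ = cong g (On-single {Q = o ≡_} refl i o≤i i<o+1)
prune-only (a ⊻ b) {g} {o} {i} o≤i i<o+t drop with i <? o + leaves a
... | yes i<mid =
  trans (cong₂ _⊻ᵐ_ (prune-only a o≤i i<mid (On-left (leaves a) drop))
                    (prune-dropAll b λ p mid≤p p< →
                       On-right (leaves a) drop p mid≤p p< (>⇒≢ (<-≤-trans i<mid mid≤p))))
        (⊻ᵐ-identityʳ (g i))
... | no i≮mid =
  trans (cong (_⊻ᵐ prune b g (o + leaves a))
              (prune-dropAll a λ p o≤p p<mid →
                 On-left (leaves a) drop p o≤p p<mid (<⇒≢ (<-≤-trans p<mid (≮⇒≥ i≮mid)))))
        (prune-only b (≮⇒≥ i≮mid) (subst (i <_) (sym (+-assoc o (leaves a) (leaves b))) i<o+t)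
                    (On-right (leaves a) drop))

leafIf : ∀ {A : Set} → Dec A → Maybe Tree
leafIf (yes _) = just ∣
leafIf (no  _) = nothing

leafIf-yes : ∀ {A : Set} {a? : Dec A} → A → leafIf a? ≡ just ∣
leafIf-yes {a? = yes _}  _ = refl
leafIf-yes {a? = no ¬a} a = contradiction a ¬a

leafIf-no : ∀ {A : Set} {a? : Dec A} → ¬ A → leafIf a? ≡ nothing
leafIf-no {a? = yes a} ¬a = contradiction a ¬a
leafIf-no {a? = no _}  _  = refl

module _ (P : ℕ → ℕ) where

  Fits : (ℕ → Tree) → ℕ → ℕ → Set
  Fits F q n = On q n (λ j → P j + leaves (F j) ≡ P (suc j))

  Fits-cong : ∀ {F G q n} → On q n (λ j → F j ≡ G j) → Fits F q n → Fits G q n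
  Fits-cong F≗G fits j q≤j j< = subst (λ x → P j + leaves x ≡ P (suc j)) (F≗G j q≤j j<) (fits j q≤j j<)

  graftAll-leaves : ∀ t {F q} → Fits F q (leaves t) → P q + leaves (graftAll t F q) ≡ P (q + leaves t)
  graftAll-leaves ∣       {F} {q} fits = trans (On-here fits) (cong P (+-comm 1 q))
  graftAll-leaves (a ⊻ b) {F} {q} fits = begin
    P q + (leaves (graftAll a F q) + leaves B)  ≡⟨ sym (+-assoc (P q) _ _) ⟩
    P q + leaves (graftAll a F q) + leaves B    ≡⟨ cong (_+ leaves B) (graftAll-leaves a (On-left (leaves a) fits)) ⟩
    P (q + leaves a) + leaves B                 ≡⟨ graftAll-leaves b (On-right (leaves a) fits) ⟩
    P (q + leaves a + leaves b)                 ≡⟨ cong P (+-assoc q (leaves a) (leaves b)) ⟩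
    P (q + (leaves a + leaves b))               ∎
    where
    open ≡-Reasoning
    B = graftAll b F (q + leaves a)

  graftAll-span : ∀ t {F q} → Fits F q (leaves t) →
    On q (leaves t) (λ j → Span (graftAll t F q) (P q) (P j) (P (suc j)))
  graftAll-span ∣ {F} {q} fits = On-single (subst (Span (F q) (P q) (P q)) (On-here fits) root)
  graftAll-span (a ⊻ b) fits =
    On-join (leaves a) (On-map inLeft (graftAll-span a fitsₐ))
      (On-map (inRight ∘ Span-offset (sym (graftAll-leaves a fitsₐ))) (graftAll-span b (On-right (leaves a) fits)))
    where fitsₐ = On-left (leaves a) fits

  prune-graftAll : ∀ t {F q} g → Fits F q (leaves t) →
    prune (graftAll t F q) g (P q) ≡ prune t (λ j → prune (F j) g (P j)) q
  prune-graftAll ∣       g fits = refl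
  prune-graftAll (a ⊻ b) {F} {q} g fits =
    cong₂ _⊻ᵐ_ (prune-graftAll a g fitsₐ)
      (trans (cong (prune (graftAll b F (q + leaves a)) g) (graftAll-leaves a fitsₐ))
             (prune-graftAll b g (On-right (leaves a) fits)))
    where fitsₐ = On-left (leaves a) fits

module Blocks (P : ℕ → ℕ) (P-step : ∀ j → P j < P (suc j)) where

  P-strict : ∀ {j k} → j < k → P j < P k
  P-strict {j} {suc k} j<1+k with m<1+n⇒m<n∨m≡n j<1+k
  ... | inj₁ j<k  = <-trans (P-strict j<k) (P-step k)
  ... | inj₂ refl = P-step j

  P-mono : ∀ {j k} → j ≤ k → P j ≤ P k
  P-mono j≤k with m≤n⇒m<n∨m≡n j≤k
  ... | inj₁ j<k  = <⇒≤ (P-strict j<k)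
  ... | inj₂ refl = ≤-refl

  P-cancel-< : ∀ {j k} → P j < P k → j < k
  P-cancel-< Pj<Pk = ≰⇒> λ k≤j → <⇒≱ Pj<Pk (P-mono k≤j)

  P-injective : ∀ {j k} → P j ≡ P k → j ≡ k
  P-injective Pj≡Pk = ≤-antisym (≮⇒≥ λ k<j → <⇒≢ (P-strict k<j) (sym Pj≡Pk))
                                (≮⇒≥ λ j<k → <⇒≢ (P-strict j<k) Pj≡Pk)

  ≤P : ∀ j → j ≤ P j
  ≤P zero    = z≤n
  ≤P (suc j) = ≤-trans (s≤s (≤P j)) (P-step j)

  -- The search bound suffices: p = P j forces j ≤ p by ≤P.
  blockStart : ℕ → Maybe Tree
  blockStart p = leafIf (p ∈? applyUpTo P (suc p))

  blockStart-P : ∀ j → blockStart (P j) ≡ just ∣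
  blockStart-P j = leafIf-yes (∈-applyUpTo⁺ P (s≤s (≤P j)))

  blockStart-inner : ∀ {j p} → P j < p → p < P (suc j) → blockStart p ≡ nothing
  blockStart-inner Pj<p p<Pj′ = leafIf-no λ p∈ → case ∈-applyUpTo⁻ P p∈ of λ where
    (k , _ , refl) → <⇒≱ p<Pj′ (P-mono (P-cancel-< Pj<p))

  inBlock : ℕ → ℕ → Maybe Tree
  inBlock i p = leafIf (P i ≤? p ×-dec p <? P (suc i))

  prune-blockStart : ∀ {F q n} → Fits P F q n → On q n (λ j → prune (F j) blockStart (P j) ≡ just ∣)
  prune-blockStart {F} fits j q≤j j< =
    trans (prune-only (F j) ≤-refl (m<m+n (P j) (leaves-positive (F j)))
             λ p Pj≤p p< p≢Pj →
               blockStart-inner (≤∧≢⇒< Pj≤p (p≢Pj ∘ sym)) (subst (p <_) (fits j q≤j j<) p<))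
          (blockStart-P j)

  prune-inBlock-other : ∀ {F q n i} → Fits P F q n →
    On q n (λ j → j ≢ i → prune (F j) (inBlock i) (P j) ≡ nothing)
  prune-inBlock-other {F} {i = i} fits j q≤j j< j≢i =
    prune-dropAll (F j) λ p Pj≤p p< → leafIf-no λ (Pi≤p , p<Pi′) →
    case <-cmp j i of λ where
      (tri< j<i _ _) → <⇒≱ (subst (p <_) (fits j q≤j j<) p<) (≤-trans (P-mono j<i) Pi≤p)
      (tri≈ _ j≡i _) → j≢i j≡i
      (tri> _ _ i<j) → <⇒≱ p<Pi′ (≤-trans (P-mono i<j) Pj≤p)

  prune-inBlock-own : ∀ {F q n i} → Fits P F q n → q ≤ i → i < q + n →
    prune (F i) (inBlock i) (P i) ≡ just (F i)
  prune-inBlock-own {F} {i = i} fits q≤i i< =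
    prune-keepAll (F i) λ p Pi≤p p< → leafIf-yes (Pi≤p , subst (p <_) (fits i q≤i i<) p<)

  graftAll-≤T⇒≤T : ∀ {t w F G q} → Fits P F q (leaves t) → Fits P G q (leaves w) →
    graftAll t F q ≤T graftAll w G q → t ≤T w
  graftAll-≤T⇒≤T {t} {w} {q = q} fitsF fitsG le =
    drop-just (subst₂ (Pointwise _≤T_) (collapse t fitsF) (collapse w fitsG) (prune-mono le blockStart (P q)))
    where
    collapse : ∀ t {F} → Fits P F q (leaves t) → prune (graftAll t F q) blockStart (P q) ≡ just t
    collapse t {F} fits = trans (prune-graftAll P t blockStart fits) (prune-keepAll t (prune-blockStart {F} fits))

  graftAll-≤T⇒grafted-≤T : ∀ {t w F G q} → Fits P F q (leaves t) → Fits P G q (leaves w) →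
    leaves t ≡ leaves w → graftAll t F q ≤T graftAll w G q → On q (leaves t) (λ i → F i ≤T G i)
  graftAll-≤T⇒grafted-≤T {t} {w} {q = q} fitsF fitsG t≡w le i q≤i i<t =
    drop-just (subst₂ (Pointwise _≤T_) (extract t fitsF i<t) (extract w fitsG (subst (λ n → i < q + n) t≡w i<t))
                                       (prune-mono le (inBlock i) (P q)))
    where
    extract : ∀ t {F} → Fits P F q (leaves t) → i < q + leaves t →
      prune (graftAll t F q) (inBlock i) (P q) ≡ just (F i)
    extract t {F} fits i< = trans (prune-graftAll P t (inBlock i) fits)
      (trans (prune-only t q≤i i< (prune-inBlock-other {F} fits)) (prune-inBlock-own {F} fits q≤i i<))

  block-containing : ∀ {q x} q′ → P q ≤ x → x < P q′ →
    Σ[ m ∈ ℕ ] q ≤ m × m < q′ × P m ≤ x × x < P (suc m)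
  block-containing zero Pq≤x x<P0 = contradiction (≤-trans (P-mono z≤n) Pq≤x) (<⇒≱ x<P0)
  block-containing {q} {x} (suc k) Pq≤x x<Pk′ with x <? P k
  ... | yes x<Pk with block-containing k Pq≤x x<Pk
  ...   | m , q≤m , m<k , found = m , q≤m , m<n⇒m<1+n m<k , found
  block-containing {q} {x} (suc k) Pq≤x x<Pk′ | no x≮Pk =
    k , ≮⇒≥ (λ k<q → <⇒≱ x<Pk′ (≤-trans (P-mono k<q) Pq≤x)) , ≤-refl , ≮⇒≥ x≮Pk , x<Pk′

  BlockSpans : Tree → ℕ → ℕ → ℕ → Set
  BlockSpans u o q q′ = ∀ j → q ≤ j → j < q′ → Span u o (P j) (P (suc j))

  Decomposition : Tree → ℕ → ℕ → Set
  Decomposition u q q′ = Σ[ u₀ ∈ Tree ] Σ[ G ∈ (ℕ → Tree) ]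
    q + leaves u₀ ≡ q′ × Fits P G q (leaves u₀) × u ≡ graftAll u₀ G q

  -- The block containing the first leaf of b cannot reach back into a (it would be the whole
  -- tree, hence the only block), so it starts there.
  split-blocks : ∀ {a b o q q′} → P q ≡ o → P q′ ≡ o + leaves (a ⊻ b) → q′ ≢ suc q →
    BlockSpans (a ⊻ b) o q q′ → Σ[ m ∈ ℕ ] P m ≡ o + leaves a × BlockSpans a o q m × BlockSpans b (o + leaves a) m q′
  split-blocks {a} {b} {o} {q} {q′} Pq≡o Pq′≡end q′≢1+q spans
    with block-containing q′ (≤-trans (≤-reflexive Pq≡o) (m≤m+n o (leaves a))) mid<Pq′
    where
    mid<Pq′ : o + leaves a < P q′
    mid<Pq′ = subst (o + leaves a <_) (sym Pq′≡end) (+-monoʳ-< o (m<m+n (leaves a) (leaves-positive b)))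
  ... | m , q≤m , m<q′ , Pm≤mid , mid<Pm′ = m , Pm≡mid , spansₐ , spans_b
    where
    Pm≡mid : P m ≡ o + leaves a
    Pm≡mid with m≤n⇒m<n∨m≡n Pm≤mid
    ... | inj₂ Pm≡mid = Pm≡mid
    ... | inj₁ Pm<mid with Span-⊻-crossing (spans m q≤m m<q′) Pm<mid mid<Pm′
    ...   | Pm≡o , Pm′≡end = contradiction
              (trans (sym (P-injective (trans Pm′≡end (sym Pq′≡end))))
                     (cong suc (P-injective (trans Pm≡o (sym Pq≡o)))))
              q′≢1+q
    spansₐ : BlockSpans a o q m
    spansₐ j q≤j j<m =
      Span-⊻⁻ˡ (spans j q≤j (<-trans j<m m<q′)) (≤-trans (P-mono j<m) (≤-reflexive Pm≡mid))
    spans_b : BlockSpans b (o + leaves a) m q′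
    spans_b j m≤j j<q′ =
      Span-⊻⁻ʳ (spans j (≤-trans q≤m m≤j) j<q′) (≤-trans (≤-reflexive (sym Pm≡mid)) (P-mono m≤j))

  Decomposition-⊻ : ∀ {a b q m q′} → Decomposition a q m → Decomposition b m q′ →
    Decomposition (a ⊻ b) q q′
  Decomposition-⊻ {q = q} (a₀ , Gₐ , refl , fitsₐ , refl) (b₀ , G_b , refl , fits_b , refl) =
    a₀ ⊻ b₀ , G , sym (+-assoc q (leaves a₀) (leaves b₀)) ,
    On-join (leaves a₀) (Fits-cong P G≗Gₐ fitsₐ) (Fits-cong P G≗G_b fits_b) ,
    cong₂ _⊻_ (graftAll-cong a₀ G≗Gₐ) (graftAll-cong b₀ G≗G_b)
    where
    G = splice (q + leaves a₀) Gₐ G_b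
    G≗Gₐ : On q (leaves a₀) (λ j → Gₐ j ≡ G j)
    G≗Gₐ _ _ = sym ∘ splice-<
    G≗G_b : On (q + leaves a₀) (leaves b₀) (λ j → G_b j ≡ G j)
    G≗G_b _ m≤j _ = sym (splice-≥ m≤j)

  decompose : ∀ u {o q q′} → P q ≡ o → P q′ ≡ o + leaves u → BlockSpans u o q q′ →
    Decomposition u q q′
  decompose u {o} {q} {q′} Pq≡o Pq′≡end spans with q′ ≟ suc q
  ... | yes refl = ∣ , (λ _ → u) , +-comm q 1 , On-single (trans (cong (_+ leaves u) Pq≡o) (sym Pq′≡end)) , refl
  decompose ∣ {o} {q} {q′} Pq≡o Pq′≡end spans | no q′≢1+q =
    contradiction (sym (P-injective (trans (Span-∣-end (spans q ≤-refl q<q′)) (sym Pq′≡end)))) q′≢1+q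
    where
    q<q′ : q < q′
    q<q′ = P-cancel-< (subst₂ _<_ (sym Pq≡o) (sym Pq′≡end) (m<m+n o z<s))
  decompose (a ⊻ b) {o} Pq≡o Pq′≡end spans | no q′≢1+q with split-blocks Pq≡o Pq′≡end q′≢1+q spans
  ... | m , Pm≡mid , spansₐ , spans_b =
    Decomposition-⊻ (decompose a Pq≡o Pm≡mid spansₐ)
                    (decompose b Pm≡mid (trans Pq′≡end (sym (+-assoc o (leaves a) (leaves b)))) spans_b)

  interval-decomposes : ∀ {t w F G q u} → Fits P F q (leaves t) → Fits P G q (leaves w) → leaves t ≡ leaves w →
    graftAll t F q ≤T u → u ≤T graftAll w G q → Decomposition u q (q + leaves t)
  interval-decomposes {t} {w} {q = q} {u} fitsF fitsG t≡w t≤u u≤w = decompose u refl end blocks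
    where
    end : P (q + leaves t) ≡ P q + leaves u
    end = trans (sym (graftAll-leaves P t fitsF)) (cong (P q +_) (≤T⇒leaves≡ t≤u))
    blocks : BlockSpans u (P q) q (q + leaves t)
    blocks j q≤j j<t = Span-between t≤u u≤w (graftAll-span P t fitsF j q≤j j<t)
                                            (graftAll-span P w fitsG j q≤j (subst (λ n → j < q + n) t≡w j<t))

offsets : (ℕ → Tree) → ℕ → ℕ
offsets F zero    = 0
offsets F (suc j) = offsets F j + leaves (F j)

offsets-step : ∀ F j → offsets F j < offsets F (suc j)
offsets-step F j = m<m+n (offsets F j) (leaves-positive (F j))

module Composites {r} (t₀ w₀ : Tree) (ts ws : Vec Tree r) (t₀∶r : leaves t₀ ≡ r) (w₀∶r : leaves w₀ ≡ r)
                  (ws∶ts : ∀ i → leaves (lookup ws i) ≡ leaves (lookup ts i)) where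

  private
    F G : ℕ → Tree
    F = lookupFrom ∣ 0 ts
    G = lookupFrom ∣ 0 ws

    open Blocks (offsets F) (offsets-step F)

    fitsF : Fits (offsets F) F 0 (leaves t₀)
    fitsF _ _ _ = refl

    fitsG : Fits (offsets F) G 0 (leaves w₀)
    fitsG j _ j<w₀ = cong (offsets F j +_)
      (lookupFrom-pointwise {d = ∣} {∣} {λ x y → leaves x ≡ leaves y} {xs = ws} {ts} ws∶ts
                            (subst (j <_) w₀∶r j<w₀))

    t₀≡w₀ : leaves t₀ ≡ leaves w₀
    t₀≡w₀ = trans t₀∶r (sym w₀∶r)

    toℕ<leaves : ∀ t → leaves t ≡ r → (i : Fin r) → toℕ i < leaves t
    toℕ<leaves _ t∶r i = subst (toℕ i <_) (sym t∶r) (toℕ<n i)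

  ∘̲-≤T⇒factors-≤T : t₀ ∘̲ ts ≤T w₀ ∘̲ ws → t₀ ≤T w₀ × (∀ i → lookup ts i ≤T lookup ws i)
  ∘̲-≤T⇒factors-≤T t≤w =
    graftAll-≤T⇒≤T {t₀} {w₀} {F} {G} fitsF fitsG t≤w′ ,
    λ i → subst₂ _≤T_ (lookupFrom-toℕ ts i) (lookupFrom-toℕ ws i)
            (graftAll-≤T⇒grafted-≤T {t₀} {w₀} {F} {G} fitsF fitsG t₀≡w₀ t≤w′
                                     (toℕ i) z≤n (toℕ<leaves t₀ t₀∶r i))
    where t≤w′ = subst₂ _≤T_ (∘̲≡graftAll t₀ ts) (∘̲≡graftAll w₀ ws) t≤w

  ∘̲-interval-decomposes : ∀ u → t₀ ∘̲ ts ≤T u → u ≤T w₀ ∘̲ ws →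
    Σ[ u₀ ∈ Tree ] Σ[ us ∈ Vec Tree r ]
      leaves u₀ ≡ r × (∀ i → leaves (lookup us i) ≡ leaves (lookup ts i)) × u ≡ u₀ ∘̲ us
  ∘̲-interval-decomposes u t≤u u≤w
    with interval-decomposes {t₀} {w₀} {F} {G} fitsF fitsG t₀≡w₀
           (subst (_≤T u) (∘̲≡graftAll t₀ ts) t≤u) (subst (u ≤T_) (∘̲≡graftAll w₀ ws) u≤w)
  ... | u₀ , H , u₀∶t₀ , fitsH , refl =
    u₀ , tabulate (H ∘ toℕ) , u₀∶r ,
    (λ i → trans (cong leaves (lookup∘tabulate (H ∘ toℕ) i))
             (trans (+-cancelˡ-≡ (offsets F (toℕ i)) _ _ (fitsH (toℕ i) z≤n (toℕ<leaves u₀ u₀∶r i)))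
                    (cong leaves (lookupFrom-toℕ ts i)))) ,
    graftAll≡∘̲ u₀ H u₀∶r
    where
    u₀∶r : leaves u₀ ≡ r
    u₀∶r = trans u₀∶t₀ t₀∶r

lemma2p14 : (n r : ℕ) (ns : Vec ℕ r) → sum ns ≡ n →
    (t₀ w₀ : Tree) (ts ws : Vec Tree r) →
    leaves t₀ ≡ r → leaves w₀ ≡ r →
    (∀ i → leaves (lookup ts i) ≡ lookup ns i) →
    (∀ i → leaves (lookup ws i) ≡ lookup ns i) →
    (t w : Tree) → t ≡ t₀ ∘̲ ts → w ≡ w₀ ∘̲ ws →
    leaves t ≡ n → leaves w ≡ n →
      (t ≤T w → (t₀ ≤T w₀) × (∀ (i : Fin r) → lookup ts i ≤T lookup ws i))
    × (∀ (u : Tree) → t ≤T u → u ≤T w →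
         Σ[ u₀ ∈ Tree ] Σ[ us ∈ Vec Tree r ]
           (leaves u₀ ≡ r) × (∀ i → leaves (lookup us i) ≡ lookup ns i)
           × (u ≡ u₀ ∘̲ us))
-- The hypotheses on n follow from the others.
lemma2p14 _ _ ns _ t₀ w₀ ts ws t₀∶r w₀∶r ts∶ns ws∶ns _ _ refl refl _ _ =
  ∘̲-≤T⇒factors-≤T , λ u t≤u u≤w → case ∘̲-interval-decomposes u t≤u u≤w of λ where
    (u₀ , us , u₀∶r , us∶ts , u≡u₀∘̲us) →
      u₀ , us , u₀∶r , (λ i → trans (us∶ts i) (ts∶ns i)) , u≡u₀∘̲us
  where open Composites t₀ w₀ ts ws t₀∶r w₀∶r (λ i → trans (ws∶ns i) (sym (ts∶ns i)))
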